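{- Let $K$ be the absolute constant described in the context, let $k$ be a positive integer and let $d$ be sufficiently large. Let $Q=(V,E)$ be a component of $Q_{d,k}$, let $p\in(0,1]$, $\epsilon_0=2^{ -d}/K$, and let $E'\subseteq E$ satisfy property (P): for every $\epsilon\ge\epsilon_0$, every $A\subseteq V$ with $|A|=|V|/2$ and $|E(A,V\setminus A)|=(1+\epsilon)\binom{d-1}{k-1}\frac{|V|}{2}$, and every coordinate cut $S$ in $Q$ with $|A\triangle S|\le K\epsilon2^d$, one has $|E(A,V\setminus A)\cap E'|\ge|E(S,V\setminus S)\cap E'|+\frac{p\epsilon}{2}\binom{d-1}{k-1}\frac{|V|}{2}$. Then for every $A\subseteq V$ with $|A|=|V|/2$, $$|E(A,V\setminus A)\cap E'|\ge|E(S,V\setminus S)\cap E'|,$$ where $S$ is a coordinate cut in $Q$ with the smallest Hamming distance $|A\triangle S|$ to $A$.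
   Context: $Q_{d,k}$ is the graph on $\{0,1\}^d$ in which two vertices are adjacent iff their Hamming distance is exactly $k$. A component of $Q_{d,k}$ is: $Q_{d,k}$ itself if $k$ is odd; if $k$ is even, the subgraph induced by the vertices of even Hamming weight or by those of odd Hamming weight. $E(A,V\setminus A)$ is the set of edges of $Q$ with exactly one endpoint in $A$. A coordinate cut in $Q$ is a set $S_{j,b}\cap V$ with $S_{j,b}=\{x:x_j=b\}$. $K$ is an absolute constant with the property: for every integer $k$, every sufficiently large $d$, every component $Q=(V,E)$ of $Q_{d,k}$, every $\epsilon\ge0$ and every $A\subseteq V$ with $|A|=|V|/2$ and $|E(A,V\setminus A)|\le(1+\epsilon)\binom{d-1}{k-1}|A|$, there is a coordinate cut $S$ in $Q$ with $|A\triangle S|\le K\epsilon 2^d$.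
   Formalization: The absolute constant K is taken to be a positive rational, and the parameter p ranges over the rationals in (0,1]. -}

module Defs where

open import Data.Bool using (Bool; true; false; _∧_; not; _xor_; if_then_else_)
open import Data.Bool.Properties using () renaming (_≟_ to _≟ᵇ_)
open import Data.Nat as ℕ using (ℕ; zero; suc; _+_; _*_; _^_; _∸_; _≡ᵇ_)
open import Data.Nat.Properties using (m^n≢0)
open import Data.Nat.Combinatorics using (_C_)
open import Data.Integer using (+_)
open import Data.Rational as ℚ using (ℚ; _/_; _÷_; Positive)
open import Data.Rational.Properties using (pos⇒nonZero)
open import Data.Fin using (Fin)
open import Data.Product using (_×_; _,_; Σ)
open import Data.Vec using (Vec; []; _∷_; lookup; zipWith; foldr)
open import Data.List as List using (List; []; _∷_; _++_; map; concatMap)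
open import Relation.Nullary.Decidable.Core using (does)
open import Relation.Binary.PropositionalEquality using (_≡_)

Vertex : ℕ → Set
Vertex d = Vec Bool d

allVertices : (d : ℕ) → List (Vertex d)
allVertices zero    = [] ∷ []
allVertices (suc d) = map (false ∷_) (allVertices d) ++ map (true ∷_) (allVertices d)

allPairs : (d : ℕ) → List (Vertex d × Vertex d)
allPairs d = concatMap (λ x → map (x ,_) (allVertices d)) (allVertices d)

countB : {A : Set} → (A → Bool) → List A → ℕ
countB P []       = 0
countB P (x ∷ xs) = (if P x then 1 else 0) + countB P xs

weight : {d : ℕ} → Vertex d → ℕ
weight = foldr _ (λ b n → (if b then 1 else 0) + n) 0

hamming : {d : ℕ} → Vertex d → Vertex d → ℕ
hamming x y = weight (zipWith _xor_ x y)

parity : {d : ℕ} → Vertex d → Bool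
parity = foldr _ _xor_ false

isEven : ℕ → Bool
isEven zero          = true
isEven (suc zero)    = false
isEven (suc (suc n)) = isEven n

-- Components of Q_{d,k}, indexed by c : Bool.
-- If k is odd the component is the whole cube (for either value of c).
inV : (d k : ℕ) (c : Bool) → Vertex d → Bool
inV d k c x = if isEven k then does (parity x ≟ᵇ c) else true

sizeV : (d k : ℕ) (c : Bool) → ℕ
sizeV d k c = countB (inV d k c) (allVertices d)

adj : (d k : ℕ) → Vertex d → Vertex d → Bool
adj d k x y = hamming x y ≡ᵇ k

VSubset : (d k : ℕ) (c : Bool) → (Vertex d → Bool) → Set
VSubset d k c A = ∀ x → A x ≡ true → inV d k c x ≡ true

sizeS : (d : ℕ) → (Vertex d → Bool) → ℕ
sizeS d A = countB A (allVertices d)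

-- A set E' ⊆ E of (unordered) edges of Q, encoded as a symmetric Boolean
-- relation all of whose related pairs are edges of Q.
EdgeSubset : (d k : ℕ) (c : Bool) → (Vertex d → Vertex d → Bool) → Set
EdgeSubset d k c E' =
  (∀ x y → E' x y ≡ E' y x) ×
  (∀ x y → E' x y ≡ true →
     (inV d k c x ≡ true) × ((inV d k c y ≡ true) × (adj d k x y ≡ true)))

-- |E(A, V ∖ A) ∩ F| for a symmetric edge relation F: each unordered edge
-- {x,y} of Q with x ∈ A, y ∈ V ∖ A is counted exactly once, via the ordered
-- pair (x , y).
cutIn : (d k : ℕ) (c : Bool) → (Vertex d → Bool) → (Vertex d → Vertex d → Bool) → ℕ
cutIn d k c A F = countB P (allPairs d)
  where
    P : Vertex d × Vertex d → Bool
    P (x , y) = inV d k c x ∧ inV d k c y ∧ A x ∧ not (A y) ∧ adj d k x y ∧ F x y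

cut : (d k : ℕ) (c : Bool) → (Vertex d → Bool) → ℕ
cut d k c A = cutIn d k c A (λ _ _ → true)

coordCut : (d k : ℕ) (c : Bool) → Fin d → Bool → Vertex d → Bool
coordCut d k c j b x = inV d k c x ∧ does (lookup x j ≟ᵇ b)

symDiff : (d : ℕ) → (Vertex d → Bool) → (Vertex d → Bool) → ℕ
symDiff d A S = countB (λ x → A x xor S x) (allVertices d)

ℕ→ℚ : ℕ → ℚ
ℕ→ℚ n = + n / 1

B : (d k : ℕ) → ℚ
B d k = ℕ→ℚ ((d ∸ 1) C (k ∸ 1))

eps0 : (d : ℕ) (K : ℚ) → .{{Positive K}} → ℚ
eps0 d K = _÷_ (+ 1 / (2 ^ d)) K {{pos⇒nonZero K}}
  where instance _ = m^n≢0 2 d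

StabilityAt : (K : ℚ) (k d : ℕ) → Set
StabilityAt K k d =
  ∀ (c : Bool) (ε : ℚ) (A : Vertex d → Bool) →
  ℚ.0ℚ ℚ.≤ ε → VSubset d k c A → 2 * sizeS d A ≡ sizeV d k c →
  ℕ→ℚ (cut d k c A) ℚ.≤ (ℚ.1ℚ ℚ.+ ε) ℚ.* B d k ℚ.* ℕ→ℚ (sizeS d A) →
  Σ (Fin d) (λ j → Σ Bool (λ b →
    ℕ→ℚ (symDiff d A (coordCut d k c j b)) ℚ.≤ K ℚ.* ε ℚ.* ℕ→ℚ (2 ^ d)))

StabilityConstant : ℚ → Set
StabilityConstant K =
  ∀ (k : ℕ) → 1 ℕ.≤ k → Σ ℕ (λ d₀ → ∀ (d : ℕ) → d₀ ℕ.≤ d → StabilityAt K k d)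

PropertyP : (d k : ℕ) (c : Bool) (K : ℚ) → .{{Positive K}} → (p : ℚ) →
            (Vertex d → Vertex d → Bool) → Set
PropertyP d k c K p E' =
  ∀ (ε : ℚ) (A : Vertex d → Bool) (j : Fin d) (b : Bool) →
  eps0 d K ℚ.≤ ε → VSubset d k c A → 2 * sizeS d A ≡ sizeV d k c →
  ℕ→ℚ (cut d k c A) ≡ (ℚ.1ℚ ℚ.+ ε) ℚ.* B d k ℚ.* (ℕ→ℚ (sizeV d k c) ℚ.* ℚ.½) →
  ℕ→ℚ (symDiff d A (coordCut d k c j b)) ℚ.≤ K ℚ.* ε ℚ.* ℕ→ℚ (2 ^ d) →
  ℕ→ℚ (cutIn d k c (coordCut d k c j b) E')
    ℚ.+ (p ℚ.* ε ℚ.* ℚ.½) ℚ.* B d k ℚ.* (ℕ→ℚ (sizeV d k c) ℚ.* ℚ.½)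
  ℚ.≤ ℕ→ℚ (cutIn d k c A E')

-- Write |E(A, V ∖ A)| = (1 + ε) binom(d-1, k-1) |A|. If ε ≥ ε₀, stability puts some coordinate
-- cut, hence also the closest one S, within K ε 2^d of A, and property (P) then beats the cut
-- of S by a nonnegative amount. If ε < ε₀, stability at ε₀ gives |A △ S| ≤ K ε₀ 2^d = 1; but
-- |S| = |V|/2 = |A| makes |A △ S| even, so A = S. For d ≥ 2 every coordinate cut halves V:
-- fixing one coordinate of a vertex shifts its weight parity by that coordinate, and the two
-- parity classes of the remaining coordinates have equal size.
module Submission where

open import Defs
open import Data.Bool using (Bool; true; false; _∧_; not; _xor_; if_then_else_)
open import Data.Bool.Properties
  using (∧-identityʳ; ∧-zeroʳ; not-involutive; xor-assoc; xor-comm) renaming (_≟_ to _≟ᵇ_)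
open import Data.Nat using (ℕ; _≤_; _*_)
open import Data.Nat.Base as ℕ using (zero; suc; _+_; _∸_; _^_; z≤n; s≤s)
import Data.Nat.Properties as ℕ
open import Algebra.Properties.CommutativeSemigroup ℕ.+-commutativeSemigroup using (interchange)
open import Data.Nat.Combinatorics using (_C_; nCk+nC[k+1]≡[n+1]C[k+1])
open import Data.Nat.Coprimality using (1-coprimeTo) renaming (sym to coprime-sym)
open import Data.Nat.Solver using (module +-*-Solver)
open import Data.Integer.Base as ℤ using (+≤+)
import Data.Integer.Properties as ℤ
open import Data.Rational using (ℚ; Positive; 0ℚ; 1ℚ; _<_) renaming (_≤_ to _≤ℚ_)
open import Data.Rational.Base as ℚ using (mkℚ; _/_; ½; *≤*)
import Data.Rational.Properties as ℚ
open import Data.Rational.Solver using () renaming (module +-*-Solver to ℚ-Solver)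
open import Data.Fin using (Fin; zero; suc)
open import Data.Vec using ([]; _∷_; lookup; insertAt)
open import Data.Vec.Properties using (insertAt-lookup)
open import Data.List using (List; []; _∷_; _++_; map)
open import Data.Product using (Σ; _,_; _×_)
open import Data.Sum using (_⊎_; inj₁; inj₂)
open import Data.Empty using (⊥-elim)
open import Function using (case_of_)
open import Relation.Nullary using (yes; no)
open import Relation.Nullary.Decidable.Core using (does)
open import Relation.Binary.PropositionalEquality
  using (_≡_; _≢_; refl; sym; trans; cong; cong₂; subst; subst₂; module ≡-Reasoning)

indicator : Bool → ℕ
indicator b = if b then 1 else 0

countB-++ : {X : Set} (P : X → Bool) (xs ys : List X) →
            countB P (xs ++ ys) ≡ countB P xs + countB P ys
countB-++ P []       ys = refl
countB-++ P (x ∷ xs) ys =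
  trans (cong (indicator (P x) +_) (countB-++ P xs ys)) (sym (ℕ.+-assoc (indicator (P x)) _ _))

countB-map : {X Y : Set} (P : Y → Bool) (f : X → Y) (xs : List X) →
             countB P (map f xs) ≡ countB (λ x → P (f x)) xs
countB-map P f []       = refl
countB-map P f (x ∷ xs) = cong (indicator (P (f x)) +_) (countB-map P f xs)

countB-cong : {X : Set} {P Q : X → Bool} → (∀ x → P x ≡ Q x) → (xs : List X) →
              countB P xs ≡ countB Q xs
countB-cong P≗Q []       = refl
countB-cong P≗Q (x ∷ xs) = cong₂ _+_ (cong indicator (P≗Q x)) (countB-cong P≗Q xs)

countB-∧-const : {X : Set} (P : X → Bool) (b : Bool) (xs : List X) →
                 countB (λ x → P x ∧ b) xs ≡ (if b then countB P xs else 0)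
countB-∧-const P true  xs = countB-cong (λ x → ∧-identityʳ (P x)) xs
countB-∧-const P false []       = refl
countB-∧-const P false (x ∷ xs) =
  trans (cong (λ b → indicator b + countB (λ y → P y ∧ false) xs) (∧-zeroʳ (P x)))
        (countB-∧-const P false xs)

countB-xor : {X : Set} (P Q : X → Bool) (xs : List X) →
  countB (λ x → P x xor Q x) xs + 2 * countB (λ x → P x ∧ Q x) xs ≡ countB P xs + countB Q xs
countB-xor P Q []       = refl
countB-xor P Q (x ∷ xs) = begin
  (indicator (P x xor Q x) + X) + 2 * (indicator (P x ∧ Q x) + Y)
    ≡⟨ regroup (indicator (P x xor Q x)) X (indicator (P x ∧ Q x)) Y ⟩
  (indicator (P x xor Q x) + 2 * indicator (P x ∧ Q x)) + (X + 2 * Y)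
    ≡⟨ cong₂ _+_ (pointwise (P x) (Q x)) (countB-xor P Q xs) ⟩
  (indicator (P x) + indicator (Q x)) + (countB P xs + countB Q xs)
    ≡⟨ interchange (indicator (P x)) (indicator (Q x)) (countB P xs) (countB Q xs) ⟩
  (indicator (P x) + countB P xs) + (indicator (Q x) + countB Q xs) ∎
  where
  open ≡-Reasoning
  X Y : ℕ
  X = countB (λ y → P y xor Q y) xs
  Y = countB (λ y → P y ∧ Q y) xs
  regroup : ∀ a x b y → (a + x) + 2 * (b + y) ≡ (a + 2 * b) + (x + 2 * y)
  regroup = solve 4 (λ a x b y → (a :+ x) :+ con 2 :* (b :+ y)
                              := (a :+ con 2 :* b) :+ (x :+ con 2 :* y)) refl
    where open +-*-Solver
  pointwise : ∀ p q → indicator (p xor q) + 2 * indicator (p ∧ q) ≡ indicator p + indicator q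
  pointwise false false = refl
  pointwise false true  = refl
  pointwise true  false = refl
  pointwise true  true  = refl

sizeS-insertAt : {d : ℕ} (i : Fin (suc d)) (P : Vertex (suc d) → Bool) →
  sizeS (suc d) P ≡ sizeS d (λ x → P (insertAt x i false)) + sizeS d (λ x → P (insertAt x i true))
sizeS-insertAt {d} zero P =
  trans (countB-++ P (map (false ∷_) vs) (map (true ∷_) vs))
        (cong₂ _+_ (countB-map P (false ∷_) vs) (countB-map P (true ∷_) vs))
  where
  vs : List (Vertex d)
  vs = allVertices d
sizeS-insertAt {suc d} (suc i) P = begin
  sizeS (suc (suc d)) P
    ≡⟨ sizeS-insertAt zero P ⟩
  sizeS (suc d) (λ x → P (false ∷ x)) + sizeS (suc d) (λ x → P (true ∷ x))
    ≡⟨ cong₂ _+_ (sizeS-insertAt i _) (sizeS-insertAt i _) ⟩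
  (slice false false + slice false true) + (slice true false + slice true true)
    ≡⟨ interchange (slice false false) (slice false true) (slice true false) (slice true true) ⟩
  (slice false false + slice true false) + (slice false true + slice true true)
    ≡⟨ cong₂ _+_ (sizeS-insertAt zero (λ x → P (insertAt x (suc i) false)))
                 (sizeS-insertAt zero (λ x → P (insertAt x (suc i) true))) ⟨
  sizeS (suc d) (λ x → P (insertAt x (suc i) false)) + sizeS (suc d) (λ x → P (insertAt x (suc i) true)) ∎
  where
  open ≡-Reasoning
  slice : Bool → Bool → ℕ
  slice a b = sizeS d (λ x → P (a ∷ insertAt x i b))

sizeS-slice : {d : ℕ} (i : Fin (suc d)) (b : Bool) (P : Vertex (suc d) → Bool) →
  sizeS (suc d) (λ y → P y ∧ does (lookup y i ≟ᵇ b)) ≡ sizeS d (λ x → P (insertAt x i b))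
sizeS-slice {d} i b P =
  trans (sizeS-insertAt i _) (trans (cong₂ _+_ (restrict false) (restrict true)) (select b))
  where
  Pᵢ : Bool → Vertex d → Bool
  Pᵢ b′ x = P (insertAt x i b′)
  restrict : ∀ b′ → countB (λ x → Pᵢ b′ x ∧ does (lookup (insertAt x i b′) i ≟ᵇ b)) (allVertices d)
                  ≡ (if does (b′ ≟ᵇ b) then sizeS d (Pᵢ b′) else 0)
  restrict b′ =
    trans (countB-cong (λ x → cong (λ v → Pᵢ b′ x ∧ does (v ≟ᵇ b)) (insertAt-lookup x i b′)) (allVertices d))
          (countB-∧-const (Pᵢ b′) (does (b′ ≟ᵇ b)) (allVertices d))
  select : ∀ b → (if does (false ≟ᵇ b) then sizeS d (Pᵢ false) else 0)
                 + (if does (true ≟ᵇ b) then sizeS d (Pᵢ true) else 0) ≡ sizeS d (Pᵢ b)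
  select false = ℕ.+-identityʳ _
  select true  = refl

sizeS≡0⇒false : {d : ℕ} (P : Vertex d → Bool) → sizeS d P ≡ 0 → ∀ x → P x ≡ false
sizeS≡0⇒false {zero} P empty [] with P []
... | false = refl
... | true  = ⊥-elim (ℕ.1+n≢0 empty)
sizeS≡0⇒false {suc d} P empty (false ∷ x) =
  sizeS≡0⇒false _ (ℕ.m+n≡0⇒m≡0 _ (trans (sym (sizeS-insertAt zero P)) empty)) x
sizeS≡0⇒false {suc d} P empty (true ∷ x) =
  sizeS≡0⇒false _ (ℕ.m+n≡0⇒n≡0 _ (trans (sym (sizeS-insertAt zero P)) empty)) x

parity-insertAt : {d : ℕ} (x : Vertex d) (i : Fin (suc d)) (b : Bool) →
                  parity (insertAt x i b) ≡ b xor parity x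
parity-insertAt x       zero    b = refl
parity-insertAt (y ∷ x) (suc i) b = begin
  y xor parity (insertAt x i b) ≡⟨ cong (y xor_) (parity-insertAt x i b) ⟩
  y xor (b xor parity x)        ≡⟨ xor-assoc y b (parity x) ⟨
  (y xor b) xor parity x        ≡⟨ cong (_xor parity x) (xor-comm y b) ⟩
  (b xor y) xor parity x        ≡⟨ xor-assoc b y (parity x) ⟩
  b xor (y xor parity x)        ∎
  where open ≡-Reasoning

does-xor-≟ : ∀ b p c → does ((b xor p) ≟ᵇ c) ≡ does (p ≟ᵇ (b xor c))
does-xor-≟ false p     c     = refl
does-xor-≟ true  false false = refl
does-xor-≟ true  false true  = refl
does-xor-≟ true  true  false = refl
does-xor-≟ true  true  true  = refl

inV-insertAt : {d : ℕ} (k : ℕ) (c b : Bool) (x : Vertex d) (i : Fin (suc d)) →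
               inV (suc d) k c (insertAt x i b) ≡ inV d k (b xor c) x
inV-insertAt k c b x i =
  cong (if isEven k then_else true)
       (trans (cong (λ p → does (p ≟ᵇ c)) (parity-insertAt x i b)) (does-xor-≟ b (parity x) c))

sizeV-suc : (d k : ℕ) (c : Bool) → sizeV (suc d) k c ≡ sizeV d k c + sizeV d k (not c)
sizeV-suc d k c =
  trans (sizeS-insertAt zero (inV (suc d) k c))
        (cong₂ _+_ (countB-cong (λ x → inV-insertAt k c false x zero) (allVertices d))
                   (countB-cong (λ x → inV-insertAt k c true x zero) (allVertices d)))

sizeV-not : (d k : ℕ) (c : Bool) → sizeV (suc d) k (not c) ≡ sizeV (suc d) k c
sizeV-not d k c = begin
  sizeV (suc d) k (not c)
    ≡⟨ sizeV-suc d k (not c) ⟩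
  sizeV d k (not c) + sizeV d k (not (not c))
    ≡⟨ cong (λ c′ → sizeV d k (not c) + sizeV d k c′) (not-involutive c) ⟩
  sizeV d k (not c) + sizeV d k c
    ≡⟨ ℕ.+-comm (sizeV d k (not c)) (sizeV d k c) ⟩
  sizeV d k c + sizeV d k (not c)
    ≡⟨ sizeV-suc d k c ⟨
  sizeV (suc d) k c ∎
  where open ≡-Reasoning

sizeV-xor : (d k : ℕ) (b c : Bool) → sizeV (suc d) k (b xor c) ≡ sizeV (suc d) k c
sizeV-xor d k false c = refl
sizeV-xor d k true  c = sizeV-not d k c

sizeV>0 : (d k : ℕ) (c : Bool) → 1 ≤ d → 0 ℕ.< sizeV d k c
sizeV>0 zero       k c ()
sizeV>0 (suc zero) k c _ with isEven k | c
... | true  | false = s≤s z≤n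
... | true  | true  = s≤s z≤n
... | false | _     = s≤s z≤n
sizeV>0 (suc (suc d)) k c _ =
  subst (0 ℕ.<_) (sym (sizeV-suc (suc d) k c))
        (ℕ.<-≤-trans (sizeV>0 (suc d) k c (s≤s z≤n)) (ℕ.m≤m+n _ _))

sizeS-coordCut : (d k : ℕ) (c : Bool) (i : Fin (suc d)) (b : Bool) →
                 sizeS (suc d) (coordCut (suc d) k c i b) ≡ sizeV d k (b xor c)
sizeS-coordCut d k c i b =
  trans (sizeS-slice i b (inV (suc d) k c))
        (countB-cong (λ x → inV-insertAt k c b x i) (allVertices d))

2*sizeS-coordCut : (d k : ℕ) (c : Bool) (i : Fin d) (b : Bool) → 2 ≤ d →
                   2 * sizeS d (coordCut d k c i b) ≡ sizeV d k c
2*sizeS-coordCut (suc zero)    k c i b (s≤s ())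
2*sizeS-coordCut (suc (suc d)) k c i b _ = begin
  2 * sizeS (suc (suc d)) (coordCut (suc (suc d)) k c i b)
    ≡⟨ cong (2 *_) (trans (sizeS-coordCut (suc d) k c i b) (sizeV-xor d k b c)) ⟩
  2 * sizeV (suc d) k c
    ≡⟨ cong (sizeV (suc d) k c +_) (ℕ.+-identityʳ _) ⟩
  sizeV (suc d) k c + sizeV (suc d) k c
    ≡⟨ cong (sizeV (suc d) k c +_) (sizeV-not d k c) ⟨
  sizeV (suc d) k c + sizeV (suc d) k (not c)
    ≡⟨ sizeV-suc (suc d) k c ⟨
  sizeV (suc (suc d)) k c ∎
  where open ≡-Reasoning

-- |A △ S| + 2|A ∩ S| = |A| + |S|, so equal sizes force an even symmetric difference.
symDiff≢1 : {d : ℕ} (A S : Vertex d → Bool) → sizeS d A ≡ sizeS d S → symDiff d A S ≢ 1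
symDiff≢1 {d} A S |A|≡|S| |A△S|≡1 = ℕ.even≢odd (sizeS d A) |A∩S| (begin
  2 * sizeS d A             ≡⟨ cong (sizeS d A +_) (ℕ.+-identityʳ _) ⟩
  sizeS d A + sizeS d A     ≡⟨ cong (sizeS d A +_) |A|≡|S| ⟩
  sizeS d A + sizeS d S     ≡⟨ countB-xor A S (allVertices d) ⟨
  symDiff d A S + 2 * |A∩S| ≡⟨ cong (_+ 2 * |A∩S|) |A△S|≡1 ⟩
  suc (2 * |A∩S|)           ∎)
  where
  open ≡-Reasoning
  |A∩S| : ℕ
  |A∩S| = sizeS d (λ x → A x ∧ S x)

xor≡false⇒≡ : ∀ a s → a xor s ≡ false → a ≡ s
xor≡false⇒≡ false false _ = refl
xor≡false⇒≡ true  true  _ = refl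

symDiff≤1⇒≗ : {d : ℕ} (A S : Vertex d → Bool) → sizeS d A ≡ sizeS d S → symDiff d A S ≤ 1 →
              ∀ x → A x ≡ S x
symDiff≤1⇒≗ A S |A|≡|S| |A△S|≤1 x with ℕ.m≤n⇒m<n∨m≡n |A△S|≤1
... | inj₁ |A△S|<1 =
  xor≡false⇒≡ (A x) (S x) (sizeS≡0⇒false (λ y → A y xor S y) (ℕ.n<1⇒n≡0 |A△S|<1) x)
... | inj₂ |A△S|≡1 = ⊥-elim (symDiff≢1 A S |A|≡|S| |A△S|≡1)

cutIn-cong : (d k : ℕ) (c : Bool) {A S : Vertex d → Bool} (F : Vertex d → Vertex d → Bool) →
             (∀ x → A x ≡ S x) → cutIn d k c A F ≡ cutIn d k c S F
cutIn-cong d k c {A} {S} F A≗S = countB-cong same-crossing (allPairs d)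
  where
  crosses : (Vertex d → Bool) → Vertex d × Vertex d → Bool
  crosses A′ (x , y) = inV d k c x ∧ inV d k c y ∧ A′ x ∧ not (A′ y) ∧ adj d k x y ∧ F x y
  same-crossing : ∀ e → crosses A e ≡ crosses S e
  same-crossing (x , y) =
    cong₂ (λ a s → inV d k c x ∧ inV d k c y ∧ a ∧ not s ∧ adj d k x y ∧ F x y) (A≗S x) (A≗S y)

nCk>0 : {n k : ℕ} → k ≤ n → 0 ℕ.< n C k
nCk>0 {n}     {zero}  _         = s≤s z≤n
nCk>0 {suc n} {suc k} (s≤s k≤n) =
  subst (0 ℕ.<_) (nCk+nC[k+1]≡[n+1]C[k+1] n k) (ℕ.<-≤-trans (nCk>0 k≤n) (ℕ.m≤m+n _ _))

ℕ→ℚ-normal : (n : ℕ) → ℕ→ℚ n ≡ mkℚ (ℤ.+ n) 0 (coprime-sym (1-coprimeTo n))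
ℕ→ℚ-normal n = ℚ.↥p/↧p≡p (mkℚ (ℤ.+ n) 0 (coprime-sym (1-coprimeTo n)))

ℕ→ℚ-mono-≤ : {m n : ℕ} → m ≤ n → ℕ→ℚ m ≤ℚ ℕ→ℚ n
ℕ→ℚ-mono-≤ {m} {n} m≤n rewrite ℕ→ℚ-normal m | ℕ→ℚ-normal n =
  *≤* (subst₂ ℤ._≤_ (sym (ℤ.*-identityʳ (ℤ.+ m))) (sym (ℤ.*-identityʳ (ℤ.+ n))) (+≤+ m≤n))

ℕ→ℚ-cancel-≤ : {m n : ℕ} → ℕ→ℚ m ≤ℚ ℕ→ℚ n → m ≤ n
ℕ→ℚ-cancel-≤ {m} {n} m≤n rewrite ℕ→ℚ-normal m | ℕ→ℚ-normal n =
  ℤ.drop‿+≤+ (subst₂ ℤ._≤_ (ℤ.*-identityʳ (ℤ.+ m)) (ℤ.*-identityʳ (ℤ.+ n)) (ℚ.drop-*≤* m≤n))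

ℕ→ℚ≥0 : (n : ℕ) → 0ℚ ≤ℚ ℕ→ℚ n
ℕ→ℚ≥0 n = ℕ→ℚ-mono-≤ {0} {n} z≤n

ℕ→ℚ-pos : {n : ℕ} → 0 ℕ.< n → Positive (ℕ→ℚ n)
ℕ→ℚ-pos {suc n} _ = subst Positive (sym (ℕ→ℚ-normal (suc n))) _

ℕ→ℚ-* : (m n : ℕ) → ℕ→ℚ (m * n) ≡ ℕ→ℚ m ℚ.* ℕ→ℚ n
ℕ→ℚ-* m n rewrite ℕ→ℚ-normal m | ℕ→ℚ-normal n = cong (_/ 1) (sym (ℤ.+◃n≡+n (m * n)))

ℕ→ℚ-half : (n : ℕ) → ℕ→ℚ (2 * n) ℚ.* ½ ≡ ℕ→ℚ n
ℕ→ℚ-half n = begin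
  ℕ→ℚ (2 * n) ℚ.* ½       ≡⟨ cong (ℚ._* ½) (ℕ→ℚ-* 2 n) ⟩
  ℕ→ℚ 2 ℚ.* ℕ→ℚ n ℚ.* ½   ≡⟨ solve 3 (λ t x h → t :* x :* h := x :* (t :* h)) refl (ℕ→ℚ 2) (ℕ→ℚ n) ½ ⟩
  ℕ→ℚ n ℚ.* 1ℚ            ≡⟨ ℚ.*-identityʳ (ℕ→ℚ n) ⟩
  ℕ→ℚ n                   ∎
  where
  open ≡-Reasoning
  open ℚ-Solver

1/n*n≡1 : (n : ℕ) .{{_ : ℕ.NonZero n}} → (ℤ.+ 1 / n) ℚ.* ℕ→ℚ n ≡ 1ℚ
1/n*n≡1 (suc m) =
  trans (cong₂ ℚ._*_ (ℚ.↥p/↧p≡p (mkℚ (ℤ.+ 1) m (1-coprimeTo (suc m)))) (ℕ→ℚ-normal (suc m)))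
        (ℚ.*-inverseˡ (mkℚ (ℤ.+ suc m) 0 (coprime-sym (1-coprimeTo (suc m)))))

*-nonNeg : {p q : ℚ} → 0ℚ ≤ℚ p → 0ℚ ≤ℚ q → 0ℚ ≤ℚ p ℚ.* q
*-nonNeg {p} {q} 0≤p 0≤q =
  ℚ.nonNegative⁻¹ _ {{ℚ.nonNeg*nonNeg⇒nonNeg p {{ℚ.nonNegative 0≤p}} q {{ℚ.nonNegative 0≤q}}}}

p≤p+q : {p q : ℚ} → 0ℚ ≤ℚ q → p ≤ℚ p ℚ.+ q
p≤p+q {p} 0≤q = ℚ.≤-trans (ℚ.≤-reflexive (sym (ℚ.+-identityʳ p))) (ℚ.+-monoʳ-≤ p 0≤q)

eps0≥0 : (d : ℕ) (K : ℚ) .{{_ : Positive K}} → 0ℚ ≤ℚ eps0 d K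
eps0≥0 d K = *-nonNeg {u} {ℚ.1/ K} (ℚ.nonNegative⁻¹ u {{ℚ.normalize-nonNeg 1 (2 ^ d)}})
                                   (ℚ.nonNegative⁻¹ (ℚ.1/ K) {{ℚ.pos⇒nonNeg (ℚ.1/ K) {{ℚ.1/pos⇒pos K}}}})
  where
  instance
    2^d≢0 : ℕ.NonZero (2 ^ d)
    2^d≢0 = ℕ.m^n≢0 2 d
    K≢0 : ℚ.NonZero K
    K≢0 = ℚ.pos⇒nonZero K
  u : ℚ
  u = ℤ.+ 1 / 2 ^ d

K*eps0*2^d≡1 : (d : ℕ) (K : ℚ) .{{_ : Positive K}} → K ℚ.* eps0 d K ℚ.* ℕ→ℚ (2 ^ d) ≡ 1ℚ
K*eps0*2^d≡1 d K = begin
  K ℚ.* (u ℚ.* K⁻¹) ℚ.* ℕ→ℚ (2 ^ d)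
    ≡⟨ solve 4 (λ k u i n → k :* (u :* i) :* n := (k :* i) :* (u :* n)) refl K u K⁻¹ (ℕ→ℚ (2 ^ d)) ⟩
  (K ℚ.* K⁻¹) ℚ.* (u ℚ.* ℕ→ℚ (2 ^ d))
    ≡⟨ cong₂ ℚ._*_ (ℚ.*-inverseʳ K) (1/n*n≡1 (2 ^ d)) ⟩
  1ℚ ∎
  where
  open ≡-Reasoning
  open ℚ-Solver
  instance
    2^d≢0 : ℕ.NonZero (2 ^ d)
    2^d≢0 = ℕ.m^n≢0 2 d
    K≢0 : ℚ.NonZero K
    K≢0 = ℚ.pos⇒nonZero K
  u K⁻¹ : ℚ
  u = ℤ.+ 1 / 2 ^ d
  K⁻¹ = ℚ.1/ K

excess-dichotomy : (T : ℚ) .{{_ : Positive T}} (q e : ℚ) →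
  q ≤ℚ (1ℚ ℚ.+ e) ℚ.* T ⊎ Σ ℚ (λ ε → e ≤ℚ ε × q ≡ (1ℚ ℚ.+ ε) ℚ.* T)
excess-dichotomy T q e = case e ℚ.≤? ε of λ where
    (yes e≤ε) → inj₂ (ε , e≤ε , q≡[1+ε]T)
    (no  e≰ε) → inj₁ (ℚ.≤-trans (ℚ.≤-reflexive q≡[1+ε]T)
                       (ℚ.*-monoʳ-≤-nonNeg T {{ℚ.pos⇒nonNeg T}} (ℚ.+-monoʳ-≤ 1ℚ (ℚ.<⇒≤ (ℚ.≰⇒> e≰ε)))))
  where
  instance
    T≢0 : ℚ.NonZero T
    T≢0 = ℚ.pos⇒nonZero T
  ε : ℚ
  ε = q ℚ.* ℚ.1/ T ℚ.- 1ℚ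
  q≡[1+ε]T : q ≡ (1ℚ ℚ.+ ε) ℚ.* T
  q≡[1+ε]T = sym (begin
    (1ℚ ℚ.+ (q ℚ.* ℚ.1/ T ℚ.- 1ℚ)) ℚ.* T
      ≡⟨ solve 3 (λ q i t → (con 1ℚ :+ (q :* i :- con 1ℚ)) :* t := q :* (i :* t)) refl q (ℚ.1/ T) T ⟩
    q ℚ.* (ℚ.1/ T ℚ.* T)
      ≡⟨ cong (q ℚ.*_) (ℚ.*-inverseˡ T) ⟩
    q ℚ.* 1ℚ
      ≡⟨ ℚ.*-identityʳ q ⟩
    q ∎)
    where
    open ≡-Reasoning
    open ℚ-Solver

IsClosestCoordCut : (d k : ℕ) (c : Bool) → (Vertex d → Bool) → Fin d → Bool → Set
IsClosestCoordCut d k c A j b =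
  (j′ : Fin d) (b′ : Bool) → symDiff d A (coordCut d k c j b) ≤ symDiff d A (coordCut d k c j′ b′)

module _ {K : ℚ} .{{_ : Positive K}} {k d : ℕ} (stable : StabilityAt K k d) (2≤d : 2 ≤ d) (k≤d : k ≤ d)
         {c : Bool} {A : Vertex d → Bool} (A⊆V : VSubset d k c A) (|A|≡|V|/2 : 2 * sizeS d A ≡ sizeV d k c)
         {j : Fin d} {b : Bool} (closest : IsClosestCoordCut d k c A j b) where

  private
    S : Vertex d → Bool
    S = coordCut d k c j b

    a : ℕ
    a = sizeS d A

    |S|≡|A| : sizeS d S ≡ a
    |S|≡|A| = ℕ.*-cancelˡ-≡ _ _ 2 (trans (2*sizeS-coordCut d k c j b 2≤d) (sym |A|≡|V|/2))

    instance
      B>0 : Positive (B d k)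
      B>0 = ℕ→ℚ-pos (nCk>0 (ℕ.∸-monoˡ-≤ 1 k≤d))

      a>0 : Positive (ℕ→ℚ a)
      a>0 = ℕ→ℚ-pos (ℕ.*-cancelˡ-< 2 0 a (subst (0 ℕ.<_) (sym |A|≡|V|/2) (sizeV>0 d k c (ℕ.<⇒≤ 2≤d))))

      B*a>0 : Positive (B d k ℚ.* ℕ→ℚ a)
      B*a>0 = ℚ.pos*pos⇒pos (B d k) (ℕ→ℚ a)

  closest-within : {ε : ℚ} → 0ℚ ≤ℚ ε →
    ℕ→ℚ (cut d k c A) ≤ℚ (1ℚ ℚ.+ ε) ℚ.* B d k ℚ.* ℕ→ℚ a →
    ℕ→ℚ (symDiff d A S) ≤ℚ K ℚ.* ε ℚ.* ℕ→ℚ (2 ^ d)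
  closest-within 0≤ε cut≤ =
    let (j′ , b′ , close) = stable c _ A 0≤ε A⊆V |A|≡|V|/2 cut≤
    in ℚ.≤-trans (ℕ→ℚ-mono-≤ (closest j′ b′)) close

  nearly-isoperimetric⇒≗ : ℕ→ℚ (cut d k c A) ≤ℚ (1ℚ ℚ.+ eps0 d K) ℚ.* (B d k ℚ.* ℕ→ℚ a) →
                           ∀ x → A x ≡ S x
  nearly-isoperimetric⇒≗ cut≤ = symDiff≤1⇒≗ A S (sym |S|≡|A|) (ℕ→ℚ-cancel-≤ |A△S|≤1)
    where
    |A△S|≤1 : ℕ→ℚ (symDiff d A S) ≤ℚ 1ℚ
    |A△S|≤1 = subst (ℕ→ℚ (symDiff d A S) ≤ℚ_) (K*eps0*2^d≡1 d K)
                (closest-within (eps0≥0 d K)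
                  (ℚ.≤-trans cut≤ (ℚ.≤-reflexive (sym (ℚ.*-assoc (1ℚ ℚ.+ eps0 d K) (B d k) (ℕ→ℚ a))))))

  excess-pays : {p : ℚ} {E′ : Vertex d → Vertex d → Bool} → 0ℚ ≤ℚ p → PropertyP d k c K p E′ →
                {ε : ℚ} → eps0 d K ≤ℚ ε → ℕ→ℚ (cut d k c A) ≡ (1ℚ ℚ.+ ε) ℚ.* (B d k ℚ.* ℕ→ℚ a) →
                cutIn d k c S E′ ≤ cutIn d k c A E′
  excess-pays {p} 0≤p property-P {ε} ε₀≤ε cut≡ =
    ℕ→ℚ-cancel-≤ (ℚ.≤-trans (p≤p+q gain≥0) (property-P ε A j b ε₀≤ε A⊆V |A|≡|V|/2 cut≡′ |A△S|≤Kε2^d))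
    where
    0≤ε : 0ℚ ≤ℚ ε
    0≤ε = ℚ.≤-trans (eps0≥0 d K) ε₀≤ε
    V½ : ℚ
    V½ = ℕ→ℚ (sizeV d k c) ℚ.* ½
    V½≡a : V½ ≡ ℕ→ℚ a
    V½≡a = trans (cong (λ n → ℕ→ℚ n ℚ.* ½) (sym |A|≡|V|/2)) (ℕ→ℚ-half a)
    cut≡′ : ℕ→ℚ (cut d k c A) ≡ (1ℚ ℚ.+ ε) ℚ.* B d k ℚ.* V½
    cut≡′ = trans cut≡ (trans (sym (ℚ.*-assoc (1ℚ ℚ.+ ε) (B d k) (ℕ→ℚ a)))
                              (cong ((1ℚ ℚ.+ ε) ℚ.* B d k ℚ.*_) (sym V½≡a)))
    |A△S|≤Kε2^d : ℕ→ℚ (symDiff d A S) ≤ℚ K ℚ.* ε ℚ.* ℕ→ℚ (2 ^ d)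
    |A△S|≤Kε2^d =
      closest-within 0≤ε (ℚ.≤-reflexive (trans cut≡ (sym (ℚ.*-assoc (1ℚ ℚ.+ ε) (B d k) (ℕ→ℚ a)))))
    gain≥0 : 0ℚ ≤ℚ (p ℚ.* ε ℚ.* ½) ℚ.* B d k ℚ.* V½
    gain≥0 = *-nonNeg (*-nonNeg (*-nonNeg (*-nonNeg 0≤p 0≤ε) 0≤½) (ℕ→ℚ≥0 ((d ∸ 1) C (k ∸ 1))))
                      (*-nonNeg (ℕ→ℚ≥0 (sizeV d k c)) 0≤½)
      where
      0≤½ : 0ℚ ≤ℚ ½
      0≤½ = ℚ.nonNegative⁻¹ ½

  closest-cut-optimal : {p : ℚ} {E′ : Vertex d → Vertex d → Bool} → 0ℚ ≤ℚ p → PropertyP d k c K p E′ →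
                        cutIn d k c S E′ ≤ cutIn d k c A E′
  closest-cut-optimal {E′ = E′} 0≤p property-P =
    case excess-dichotomy (B d k ℚ.* ℕ→ℚ a) (ℕ→ℚ (cut d k c A)) (eps0 d K) of λ where
      (inj₁ cut≤) → ℕ.≤-reflexive (cutIn-cong d k c E′ (λ x → sym (nearly-isoperimetric⇒≗ cut≤ x)))
      (inj₂ (ε , ε₀≤ε , cut≡)) → excess-pays 0≤p property-P ε₀≤ε cut≡

corollary3 : (K : ℚ) → .{{_ : Positive K}} → StabilityConstant K →
    (k : ℕ) → 1 ≤ k →
    Σ ℕ (λ d₀ → (d : ℕ) → d₀ ≤ d →
      (c : Bool) (p : ℚ) → 0ℚ < p → p ≤ℚ 1ℚ →
      (E' : Vertex d → Vertex d → Bool) → EdgeSubset d k c E' →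
      PropertyP d k c K p E' →
      (A : Vertex d → Bool) → VSubset d k c A → 2 * sizeS d A ≡ sizeV d k c →
      (j : Fin d) (b : Bool) →
      ((j' : Fin d) (b' : Bool) →
        symDiff d A (coordCut d k c j b) ≤ symDiff d A (coordCut d k c j' b')) →
      cutIn d k c (coordCut d k c j b) E' ≤ cutIn d k c A E')
corollary3 K stability k 1≤k =
  let (d₀ , stable) = stability k 1≤k in
  d₀ + suc k , λ d d₀+k<d c p 0<p _ E′ _ property-P A A⊆V |A|≡|V|/2 j b closest →
    let k<d = ℕ.m+n≤o⇒n≤o d₀ d₀+k<d in
    closest-cut-optimal (stable d (ℕ.m+n≤o⇒m≤o d₀ d₀+k<d)) (ℕ.≤-trans (s≤s 1≤k) k<d) (ℕ.<⇒≤ k<d)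
                        A⊆V |A|≡|V|/2 closest (ℚ.<⇒≤ 0<p) property-P
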